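{- Let $G$ be a $5$-critical graph and let $R$ be a collapsible subset of $V(G)$. Then the critical complement of $R$ is $5$-critical.
   Context: All graphs are finite and simple. A graph is $5$-critical if it is not $4$-colorable but every proper subgraph is $4$-colorable. For $R\subseteq V(G)$, the boundary of $R$ is the set of vertices of $R$ having a neighbor in $V(G)\setminus R$. If $G$ is $5$-critical, a set $R\subsetneq V(G)$ with $|R|\ge 5$ is collapsible if in every $4$-coloring of $G[R]$ all vertices of the boundary of $R$ receive the same color. The critical complement of a collapsible $R$ is the graph obtained from $G$ by identifying all vertices of the boundary of $R$ to a single vertex (the special vertex) and deleting the remaining vertices of $R$ (deleting parallel edges). -}

module Defs where

open import Level using (0ℓ)
open import Data.Bool using (Bool; true; false; T; not)
open import Data.Fin using (Fin)
open import Data.Maybe using (Maybe; just; nothing)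
open import Data.Nat using (ℕ)
open import Data.Product using (Σ; ∃; ∃-syntax; _×_; _,_; proj₁)
open import Data.Sum using (_⊎_)
open import Data.Empty using (⊥)
open import Relation.Nullary using (¬_; Dec)
open import Relation.Binary.PropositionalEquality using (_≡_; _≢_)
open import Function.Bundles using (_↔_)
open import Function.Definitions using (Injective)

-- A simple graph: vertex type, symmetric irreflexive adjacency relation.
-- (No multi-edges: adjacency is a relation, so "parallel edges" do not exist.)
record Graph : Set₁ where
  field
    V     : Set
    Adj   : V → V → Set
    sym   : ∀ {u v} → Adj u v → Adj v u
    irr   : ∀ {v} → ¬ Adj v v
open Graph public

-- Finite graph: vertex set in bijection with some Fin n; adjacency decidable
-- (automatic for finite graphs classically).
record Finite (G : Graph) : Set where
  field
    size   : ℕ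
    enum   : V G ↔ Fin size
    adj?   : ∀ u v → Dec (Adj G u v)

IsColoring : (G : Graph) (k : ℕ) → (V G → Fin k) → Set
IsColoring G k c = ∀ u v → Adj G u v → c u ≢ c v

Colorable : ℕ → Graph → Set
Colorable k G = ∃[ c ] IsColoring G k c

record Subgraph (G : Graph) : Set where
  field
    S      : V G → Bool
    F      : V G → V G → Bool
    F⊆E    : ∀ u v → T (F u v) → Adj G u v
    F-sym  : ∀ u v → T (F u v) → T (F v u)
    F⊆S    : ∀ u v → T (F u v) → T (S u) × T (S v)
open Subgraph public

ProperSubgraph : (G : Graph) → Subgraph G → Set
ProperSubgraph G H =
  (∃[ v ] S H v ≡ false) ⊎ (∃[ u ] ∃[ v ] (Adj G u v × F H u v ≡ false))

-- k-colourability of a subgraph (colours on vertices outside S are irrelevant).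
SubColorable : (k : ℕ) (G : Graph) → Subgraph G → Set
SubColorable k G H = Σ (V G → Fin k) λ c → (∀ u v → T (F H u v) → c u ≢ c v)

FiveCritical : Graph → Set
FiveCritical G =
  ¬ Colorable 4 G × (∀ (H : Subgraph G) → ProperSubgraph G H → SubColorable 4 G H)

Subset : Graph → Set
Subset G = V G → Bool

Induced : (G : Graph) → Subset G → Graph
Induced G R = record
  { V   = Σ (V G) (λ v → T (R v))
  ; Adj = λ u v → Adj G (proj₁ u) (proj₁ v)
  ; sym = sym G
  ; irr = irr G
  }

InBoundary : (G : Graph) → Subset G → V G → Set
InBoundary G R v = T (R v) × (∃[ w ] (T (not (R w)) × Adj G v w))

AtLeast5 : (G : Graph) → Subset G → Set
AtLeast5 G R =
  Σ (Fin 5 → V G) (λ f → Injective _≡_ _≡_ f × (∀ i → T (R (f i))))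

Collapsible : (G : Graph) → Subset G → Set
Collapsible G R =
  (∃[ v ] R v ≡ false) × AtLeast5 G R ×
  (∀ (c : V (Induced G R) → Fin 4) → IsColoring (Induced G R) 4 c →
     ∀ u v (bu : InBoundary G R u) (bv : InBoundary G R v) →
     c (u , proj₁ bu) ≡ c (v , proj₁ bv))

-- Critical complement: vertices outside R, plus a special vertex (nothing)
-- obtained by identifying the boundary of R; other vertices of R deleted.
-- The special vertex is adjacent to w iff some boundary vertex is adjacent to w
-- (parallel edges are automatically merged, adjacency being a relation).
module _ (G : Graph) (R : Subset G) where
  private
    Out = Σ (V G) (λ v → T (not (R v)))

    CAdj : Maybe Out → Maybe Out → Set
    CAdj nothing  nothing  = ⊥
    CAdj nothing  (just w) = ∃[ b ] (InBoundary G R b × Adj G b (proj₁ w))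
    CAdj (just u) nothing  = ∃[ b ] (InBoundary G R b × Adj G b (proj₁ u))
    CAdj (just u) (just w) = Adj G (proj₁ u) (proj₁ w)

    CSym : ∀ {u v} → CAdj u v → CAdj v u
    CSym {nothing} {just w} p = p
    CSym {just u} {nothing} p = p
    CSym {just u} {just w} p = sym G p

    CIrr : ∀ {v} → ¬ CAdj v v
    CIrr {nothing} ()
    CIrr {just v} p = irr G p

  CriticalComplement : Graph
  CriticalComplement = record { V = Maybe Out ; Adj = CAdj ; sym = λ {u} {v} → CSym {u} {v} ; irr = λ {v} → CIrr {v} }

module Submission where

-- Deleting a vertex outside R leaves a 4-colourable graph,
-- so G[R] has a 4-colouring φ, which is constant (say a) on the boundary of R
-- by collapsibility.  Permuting the colours of a 4-colouring of G′ we may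
-- assume ⋆ gets colour a; gluing it to φ along the boundary would 4-colour G.
--
-- A proper subgraph H′ of G′ misses a
-- vertex or an edge; we delete the corresponding vertex or edge of G (for a
-- missing edge at ⋆: an edge from a boundary vertex) and 4-colour the rest
-- by criticality.  Since G[R] survives, the colouring is constant on the
-- boundary, and that colour for ⋆ together with the old colours outside R
-- colours H′.  If ⋆ itself is missing we delete all of R instead.

open import Defs
open import Data.Bool using (true; false; T; not)
open import Data.Bool.Properties using (T-irrelevant)
open import Data.Empty using (⊥; ⊥-elim)
open import Data.Fin using (Fin; zero)
open import Data.Fin.Properties using (any?) renaming (_≟_ to _≟ᶠ_)
open import Data.Fin.Permutation using (transpose; _⟨$⟩ʳ_)
open import Data.Maybe using (just; nothing)
open import Data.Nat using (ℕ)
open import Data.Product using (Σ; ∃; ∃-syntax; _×_; _,_; proj₁; proj₂)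
open import Data.Sum using (_⊎_; inj₁; inj₂)
open import Data.Unit using (tt)
open import Function using (_∘_)
open import Function.Bundles using (Inverse; Injection; mk⇔)
open import Function.Properties.Inverse using (↔⇒↣)
open import Relation.Nullary using (¬_; Dec; yes; no; ¬?)
open import Relation.Nullary.Decidable
  using (⌊_⌋; map; via-injection; toWitness; fromWitness; T?; _×-dec_; _⊎-dec_; isYes≗does; dec-true; dec-false)
open import Relation.Binary.PropositionalEquality
  using (_≡_; _≢_; refl; trans; cong; subst) renaming (sym to ≡-sym)

ProperOn : (G : Graph) → (V G → V G → Set) → (V G → Fin 4) → Set
ProperOn G Keep c = ∀ x y → Keep x y → Adj G x y → c x ≢ c y

SameEdge : {A : Set} → A → A → A → A → Set
SameEdge p q x y = (x ≡ p × y ≡ q) ⊎ (x ≡ q × y ≡ p)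

SameEdge-swap : {A : Set} {p q x y : A} → SameEdge p q x y → SameEdge p q y x
SameEdge-swap (inj₁ (x≡p , y≡q)) = inj₂ (y≡q , x≡p)
SameEdge-swap (inj₂ (x≡q , y≡p)) = inj₁ (y≡p , x≡q)

⌊⌋-false : {A : Set} (a? : Dec A) → ¬ A → ⌊ a? ⌋ ≡ false
⌊⌋-false a? ¬a = trans (isYes≗does a?) (dec-false a? ¬a)

transpose-sends : ∀ {k} (i j : Fin k) → transpose i j ⟨$⟩ʳ i ≡ j
transpose-sends i j rewrite dec-true (i ≟ᶠ i) refl = refl

recolour : (H : Graph) {k : ℕ} (c : V H → Fin k) → IsColoring H k c →
  (v : V H) (a : Fin k) → Σ (V H → Fin k) λ c′ → IsColoring H k c′ × c′ v ≡ a
recolour H c c-ok v a =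
  (π ⟨$⟩ʳ_) ∘ c , (λ x y xy → c-ok x y xy ∘ injective) , transpose-sends (c v) a
  where
  π = transpose (c v) a
  open Injection (↔⇒↣ π) using (injective)

outside : ∀ {b} → ¬ T b → T (not b)
outside {false} _   = tt
outside {true}  ¬t  = ¬t tt

not-inside : ∀ {b} → T b → ¬ T (not b)
not-inside {true} _ ()

module FiniteGraph (G : Graph) (fin : Finite G) where
  open Finite fin

  _≟_ : (x y : V G) → Dec (x ≡ y)
  _≟_ = via-injection (↔⇒↣ enum) _≟ᶠ_

  anyVertex? : {P : V G → Set} → (∀ v → Dec (P v)) → Dec (∃ P)
  anyVertex? {P} P? = map (mk⇔ (λ (i , p) → from i , p) fromVertex) (any? (P? ∘ from))
    where
    open Inverse enum using (to; from; strictlyInverseʳ)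
    fromVertex : ∃ P → ∃ (P ∘ from)
    fromVertex (v , p) = to v , subst P (≡-sym (strictlyInverseʳ v)) p

module CriticalGraph (G : Graph) (fin : Finite G) (crit : FiveCritical G) where
  open Finite fin using (adj?)
  open FiniteGraph G fin

  module _ {KeepV : V G → Set} (KeepV? : ∀ x → Dec (KeepV x))
           {KeepE : V G → V G → Set} (KeepE? : ∀ x y → Dec (KeepE x y))
           (KeepE-sym : ∀ {x y} → KeepE x y → KeepE y x) where

    Kept : V G → V G → Set
    Kept x y = KeepV x × KeepV y × KeepE x y × Adj G x y

    kept? : ∀ x y → Dec (Kept x y)
    kept? x y = KeepV? x ×-dec KeepV? y ×-dec KeepE? x y ×-dec adj? x y

    restriction : Subgraph G
    restriction = record
      { S     = λ x → ⌊ KeepV? x ⌋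
      ; F     = λ x y → ⌊ kept? x y ⌋
      ; F⊆E   = λ x y k → proj₂ (proj₂ (proj₂ (toWitness k)))
      ; F-sym = λ x y k → let (kx , ky , kxy , xy) = toWitness k
                           in fromWitness (ky , kx , KeepE-sym kxy , Graph.sym G xy)
      ; F⊆S   = λ x y k → fromWitness (proj₁ (toWitness k)) , fromWitness (proj₁ (proj₂ (toWitness k)))
      }

    restrictionColouring : (∃[ v ] ¬ KeepV v) ⊎ (∃[ p ] ∃[ q ] Adj G p q × ¬ KeepE p q) →
      Σ (V G → Fin 4) (ProperOn G (λ x y → KeepV x × KeepV y × KeepE x y))
    restrictionColouring deleted =
      let (c , c-ok) = proj₂ crit restriction (proper deleted)
      in c , λ x y (kx , ky , kxy) xy → c-ok x y (fromWitness (kx , ky , kxy , xy))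
      where
      proper : (∃[ v ] ¬ KeepV v) ⊎ (∃[ p ] ∃[ q ] Adj G p q × ¬ KeepE p q) →
        ProperSubgraph G restriction
      proper (inj₁ (v , ¬kv))           = inj₁ (v , ⌊⌋-false (KeepV? v) ¬kv)
      proper (inj₂ (p , q , pq , ¬kpq)) = inj₂ (p , q , pq , ⌊⌋-false (kept? p q) (¬kpq ∘ proj₁ ∘ proj₂ ∘ proj₂))

  deleteVertices : {KeepV : V G → Set} → (∀ x → Dec (KeepV x)) → ∃[ v ] ¬ KeepV v →
    Σ (V G → Fin 4) (ProperOn G (λ x y → KeepV x × KeepV y))
  deleteVertices KeepV? missing =
    let (c , c-ok) = restrictionColouring KeepV? (λ _ _ → yes tt) (λ _ → tt) (inj₁ missing)
    in c , λ x y (kx , ky) → c-ok x y (kx , ky , tt)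

  deleteEdge : ∀ {p q} → Adj G p q →
    Σ (V G → Fin 4) (ProperOn G (λ x y → ¬ SameEdge p q x y))
  deleteEdge {p} {q} pq =
    let (c , c-ok) = restrictionColouring (λ _ → yes tt) notSame? (_∘ SameEdge-swap)
                       (inj₂ (p , q , pq , λ ¬same → ¬same (inj₁ (refl , refl))))
    in c , λ x y ¬same → c-ok x y (tt , tt , ¬same)
    where
    notSame? : ∀ x y → Dec (¬ SameEdge p q x y)
    notSame? x y = ¬? ((x ≟ p ×-dec y ≟ q) ⊎-dec (x ≟ q ×-dec y ≟ p))

module Collapse (G : Graph) (fin : Finite G) (crit : FiveCritical G)
                (R : Subset G) (coll : Collapsible G R) where
  open Finite fin using (adj?)
  open FiniteGraph G fin
  open CriticalGraph G fin crit

  G′ : Graph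
  G′ = CriticalComplement G R

  Outside : Set
  Outside = Σ (V G) (λ v → T (not (R v)))

  ⋆ : V G′
  ⋆ = nothing

  inside≢outside : ∀ {x} → T (R x) → (y : Outside) → x ≢ proj₁ y
  inside≢outside x∈R (y , y∉R) refl = not-inside x∈R y∉R

  outside-≡ : {x y : Outside} → proj₁ x ≡ proj₁ y → x ≡ y
  outside-≡ {x , p} {.x , q} refl = cong (x ,_) (T-irrelevant p q)

  inside-not-same : ∀ {x y} → T (R x) → (p q : Outside) → ¬ SameEdge (proj₁ p) (proj₁ q) x y
  inside-not-same x∈R p q (inj₁ (x≡p , _)) = inside≢outside x∈R p x≡p
  inside-not-same x∈R p q (inj₂ (x≡q , _)) = inside≢outside x∈R q x≡q

  inBoundary? : ∀ b → Dec (InBoundary G R b)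
  inBoundary? b = T? (R b) ×-dec anyVertex? (λ w → T? (not (R w)) ×-dec adj? b w)

  -- Collapsibility: a colouring proper on G[R] is constant on the boundary
  -- (any colour will do if the boundary is empty).
  boundaryColour : ∀ {Keep} (c : V G → Fin 4) → ProperOn G Keep c →
    (∀ x y → T (R x) → T (R y) → Keep x y) →
    ∃[ a ] (∀ b → InBoundary G R b → c b ≡ a)
  boundaryColour c c-ok inside with anyVertex? inBoundary?
  ... | yes (b₀ , b₀∈∂) = c b₀ , λ b b∈∂ → proj₂ (proj₂ coll) (c ∘ proj₁) onR b b₀ b∈∂ b₀∈∂
    where
    onR : IsColoring (Induced G R) 4 (c ∘ proj₁)
    onR (x , x∈R) (y , y∈R) = c-ok x y (inside x y x∈R y∈R)
  ... | no  empty       = zero , λ b b∈∂ → ⊥-elim (empty (b , b∈∂))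

  glue : (φ : V G → Fin 4) → ProperOn G (λ x y → T (R x) × T (R y)) φ →
    (c′ : V G′ → Fin 4) → IsColoring G′ 4 c′ →
    (∀ b → InBoundary G R b → φ b ≡ c′ ⋆) → Colorable 4 G
  glue φ φ-ok c′ c′-ok ∂↦⋆ = (λ x → choose x (T? (R x))) , λ x y → choose-ok x y (T? (R x)) (T? (R y))
    where
    choose : (x : V G) → Dec (T (R x)) → Fin 4
    choose x (yes _)   = φ x
    choose x (no x∉R) = c′ (just (x , outside x∉R))

    -- An edge from x ∈ R to y ∉ R makes x a boundary vertex, so φ x = c′ ⋆,
    -- and ⋆ is adjacent to y in G′.
    crossing : ∀ x y → T (R x) → (y∉R : ¬ T (R y)) → Adj G x y →
      φ x ≢ c′ (just (y , outside y∉R))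
    crossing x y x∈R y∉R xy φx≡c′y =
      c′-ok ⋆ (just _) (x , x∈∂ , xy) (trans (≡-sym (∂↦⋆ x x∈∂)) φx≡c′y)
      where
      x∈∂ : InBoundary G R x
      x∈∂ = x∈R , y , outside y∉R , xy

    choose-ok : ∀ x y dx dy → Adj G x y → choose x dx ≢ choose y dy
    choose-ok x y (yes x∈R) (yes y∈R) xy = φ-ok x y (x∈R , y∈R) xy
    choose-ok x y (no _)    (no _)    xy = c′-ok (just _) (just _) xy
    choose-ok x y (yes x∈R) (no y∉R)  xy = crossing x y x∈R y∉R xy
    choose-ok x y (no x∉R)  (yes y∈R) xy = crossing y x y∈R x∉R (Graph.sym G xy) ∘ ≡-sym

  notColourable : ¬ Colorable 4 G′
  notColourable (c′ , c′-ok) =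
    let (v , v∉R) = proj₁ coll
        (φ , φ-ok) = deleteVertices (λ x → T? (R x)) (v , subst T v∉R)
        (a , ∂↦a) = boundaryColour φ φ-ok (λ _ _ x∈R y∈R → x∈R , y∈R)
        (c″ , c″-ok , ⋆↦a) = recolour G′ c′ c′-ok ⋆ a
    in proj₁ crit (glue φ φ-ok c″ c″-ok (λ b b∈∂ → trans (∂↦a b b∈∂) (≡-sym ⋆↦a)))

  module _ (H′ : Subgraph G′) where

    extend : (c : V G → Fin 4) (a : Fin 4) →
      (∀ x y → T (F H′ (just x) (just y)) → c (proj₁ x) ≢ c (proj₁ y)) →
      (∀ y → T (F H′ ⋆ (just y)) → a ≢ c (proj₁ y)) →
      SubColorable 4 G′ H′
    extend c a outside-ok ⋆-ok = c′ , c′-ok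
      where
      c′ : V G′ → Fin 4
      c′ nothing  = a
      c′ (just x) = c (proj₁ x)

      c′-ok : ∀ u v → T (F H′ u v) → c′ u ≢ c′ v
      c′-ok nothing  nothing  e = ⊥-elim (F⊆E H′ ⋆ ⋆ e)
      c′-ok nothing  (just y) e = ⋆-ok y e
      c′-ok (just x) nothing  e = ⋆-ok x (F-sym H′ _ _ e) ∘ ≡-sym
      c′-ok (just x) (just y) e = outside-ok x y e

    extendByBoundary : ∀ {Keep} (c : V G → Fin 4) → ProperOn G Keep c →
      (∀ x y → T (R x) → T (R y) → Keep x y) →
      (∀ x y → T (F H′ (just x) (just y)) → Keep (proj₁ x) (proj₁ y)) →
      (∀ b y → T (R b) → T (F H′ ⋆ (just y)) → Keep b (proj₁ y)) →
      SubColorable 4 G′ H′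
    extendByBoundary c c-ok inside outside-kept ⋆-kept =
      let (a , ∂↦a) = boundaryColour c c-ok inside
      in extend c a (λ x y e → c-ok _ _ (outside-kept x y e) (F⊆E H′ _ _ e)) (⋆-ok a ∂↦a)
      where
      ⋆-ok : ∀ a → (∀ b → InBoundary G R b → c b ≡ a) →
        ∀ y → T (F H′ ⋆ (just y)) → a ≢ c (proj₁ y)
      ⋆-ok a ∂↦a y e a≡cy =
        let (b , b∈∂ , by) = F⊆E H′ ⋆ (just y) e
        in c-ok b (proj₁ y) (⋆-kept b y (proj₁ b∈∂) e) by (trans (∂↦a b b∈∂) a≡cy)

    withoutStar : ¬ T (S H′ ⋆) → SubColorable 4 G′ H′
    withoutStar ⋆∉H′ =
      let (f , _ , f∈R) = proj₁ (proj₂ coll)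
          (c , c-ok) = deleteVertices (λ x → T? (not (R x))) (f zero , not-inside (f∈R zero))
      in extend c zero (λ x y e → c-ok _ _ (proj₂ x , proj₂ y) (F⊆E H′ _ _ e))
                       (λ y e → ⊥-elim (⋆∉H′ (proj₁ (F⊆S H′ ⋆ (just y) e))))

    withoutOutsideVertex : (u : Outside) → ¬ T (S H′ (just u)) → SubColorable 4 G′ H′
    withoutOutsideVertex u u∉H′ =
      let (c , c-ok) = deleteVertices (λ x → ¬? (x ≟ proj₁ u)) (proj₁ u , λ u≢u → u≢u refl)
      in extendByBoundary c c-ok
           (λ x y x∈R y∈R → inside≢outside x∈R u , inside≢outside y∈R u)
           (λ x y e → avoids x (proj₁ (F⊆S H′ _ _ e)) , avoids y (proj₂ (F⊆S H′ _ _ e)))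
           (λ b y b∈R e → inside≢outside b∈R u , avoids y (proj₂ (F⊆S H′ _ _ e)))
      where
      avoids : (x : Outside) → T (S H′ (just x)) → proj₁ x ≢ proj₁ u
      avoids x x∈H′ x≡u = u∉H′ (subst (λ z → T (S H′ (just z))) (outside-≡ x≡u) x∈H′)

    withoutOutsideEdge : (u w : Outside) → Adj G (proj₁ u) (proj₁ w) →
      ¬ T (F H′ (just u) (just w)) → SubColorable 4 G′ H′
    withoutOutsideEdge u w uw uw∉H′ =
      let (c , c-ok) = deleteEdge uw
      in extendByBoundary c c-ok
           (λ x y x∈R _ → inside-not-same x∈R u w)
           (λ x y e → λ { (inj₁ (x≡u , y≡w)) → absent e x≡u y≡w
                        ; (inj₂ (x≡w , y≡u)) → absent (F-sym H′ _ _ e) y≡u x≡w })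
           (λ b y b∈R _ → inside-not-same b∈R u w)
      where
      absent : ∀ {x y} → T (F H′ (just x) (just y)) → proj₁ x ≡ proj₁ u → proj₁ y ≡ proj₁ w → ⊥
      absent {x} {y} e x≡u y≡w with outside-≡ {x} {u} x≡u | outside-≡ {y} {w} y≡w
      ... | refl | refl = uw∉H′ e

    withoutStarEdge : (w : Outside) (b₀ : V G) → InBoundary G R b₀ →
      Adj G b₀ (proj₁ w) → ¬ T (F H′ ⋆ (just w)) → SubColorable 4 G′ H′
    withoutStarEdge w b₀ (b₀∈R , _) b₀w ⋆w∉H′ =
      let (c , c-ok) = deleteEdge b₀w
      in extendByBoundary c c-ok
           (λ x y x∈R y∈R → λ { (inj₁ (_ , y≡w)) → inside≢outside y∈R w y≡w
                              ; (inj₂ (x≡w , _)) → inside≢outside x∈R w x≡w })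
           (λ x y _ → λ { (inj₁ (x≡b₀ , _)) → inside≢outside b₀∈R x (≡-sym x≡b₀)
                        ; (inj₂ (_ , y≡b₀)) → inside≢outside b₀∈R y (≡-sym y≡b₀) })
           (λ b y b∈R e → λ { (inj₁ (_ , y≡w)) → ⋆w∉H′ (subst (λ z → T (F H′ ⋆ (just z))) (outside-≡ y≡w) e)
                            ; (inj₂ (b≡w , _)) → inside≢outside b∈R w b≡w })

    properSubgraphColourable : ProperSubgraph G′ H′ → SubColorable 4 G′ H′
    properSubgraphColourable (inj₁ (nothing , ∉H′)) = withoutStar (subst T ∉H′)
    properSubgraphColourable (inj₁ (just u  , ∉H′)) = withoutOutsideVertex u (subst T ∉H′)
    properSubgraphColourable (inj₂ (nothing , nothing , () , _))
    properSubgraphColourable (inj₂ (just u , just w , uw , ∉H′)) =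
      withoutOutsideEdge u w uw (subst T ∉H′)
    properSubgraphColourable (inj₂ (nothing , just w , (b , b∈∂ , bw) , ∉H′)) =
      withoutStarEdge w b b∈∂ bw (subst T ∉H′)
    properSubgraphColourable (inj₂ (just w , nothing , (b , b∈∂ , bw) , ∉H′)) =
      withoutStarEdge w b b∈∂ bw (subst T ∉H′ ∘ F-sym H′ _ _)

proposition3p10 : (G : Graph) → Finite G → FiveCritical G →
    (R : Subset G) → Collapsible G R → FiveCritical (CriticalComplement G R)
proposition3p10 G fin crit R coll = notColourable , properSubgraphColourable
  where open Collapse G fin crit R coll
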